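{- Let $f:X\to Y$ be a function between types connected by paths with $f(x)=y$ and transport path $\phi$ from $x$ to $y$, and let $f_{\phi}([\alpha_x]) := [\phi]\circ[\alpha_x]\circ[\sigma(\phi)] = [\tau(\tau(\sigma(\phi),\alpha_x),\phi)]$ for loops $\alpha_x$ at $x$. Then $f_{\phi}$ is a group homomorphism: for all loops $\alpha_x,\beta_x$ at $x$, $f_{\phi}([\beta_x]\circ[\alpha_x]) = f_{\phi}([\beta_x])\circ f_{\phi}([\alpha_x])$ up to rw-equality.
   Context: Computational paths: for terms $a,b$ of a type, $a=_s b$ is a formal term $s$ recording a rewrite sequence from $a$ to $b$, with constructors reflexivity $\rho$, symmetry $\sigma$ ($a=_t b\Rightarrow b=_{\sigma(t)}a$), transitivity $\tau$ ($a=_tb,\ b=_uc\Rightarrow a=_{\tau(t,u)}c$). Composition $r\circ s:=\tau(s,r)$; $[s]$ is the rw-equivalence class. rw-equality is the equivalence relation generated by one-step applications (to subterms) of the rules of the rewriting system $LND_{EQ}$-$TRS$, which include $\tau(r,\sigma(r))\rhd_{tr}\rho$, $\tau(\rho,r)\rhd_{tlr} r$, $\tau(\tau(t,r),s)\rhd_{tt}\tau(t,\tau(r,s))$. Transport path: for $f:X\to Y$ viewed as dependent function $f:\Pi_{(x:X)}P(x)$ with $P(x)\equiv Y$, transporting $x=_{\rho_x}x$ gives $\rho_x\circ f(x)=_{\mu_f(\rho_x)}f(x)$, abbreviated $x=_\phi f(x)$, treated as a computational path with inverse $\sigma(\phi)$. Loops at $x$ modulo rw-equality form a group under $\circ$.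 -}

module Defs where

open import Data.Sum using (_⊎_; inj₁; inj₂)

-- Computational paths between terms of two types X and Y (terms of both
-- types are the "points"), built from
--   * basic (axiomatic) paths in X and in Y, given by families BX, BY,
--   * the transport path  μ_f(ρ_x) : x = f(x)  for a function f : X → Y,
--   * reflexivity ρ, symmetry σ, transitivity τ.
module Paths {X Y : Set} (BX : X → X → Set) (BY : Y → Y → Set) (f : X → Y) where

  Pt : Set
  Pt = X ⊎ Y

  data Atom : Pt → Pt → Set where
    baseX : ∀ {a b} → BX a b → Atom (inj₁ a) (inj₁ b)
    baseY : ∀ {a b} → BY a b → Atom (inj₂ a) (inj₂ b)
    μ     : (x : X) → Atom (inj₁ x) (inj₂ (f x))

  data Path : Pt → Pt → Set where
    atom : ∀ {a b} → Atom a b → Path a b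
    ρ    : (a : Pt) → Path a a
    σ    : ∀ {a b} → Path a b → Path b a
    τ    : ∀ {a b c} → Path a b → Path b c → Path a c

  _∘ₚ_ : ∀ {a b c} → Path b c → Path a b → Path a c
  r ∘ₚ s = τ s r

  -- One-step rewriting (rules of LND_EQ-TRS relevant to the ρ/σ/τ fragment),
  -- applicable to subterms.
  data _▷_ : ∀ {a b} → Path a b → Path a b → Set where
    tr   : ∀ {a b} (r : Path a b) → τ r (σ r) ▷ ρ a
    tsr  : ∀ {a b} (r : Path a b) → τ (σ r) r ▷ ρ b
    tlr  : ∀ {a b} (r : Path a b) → τ (ρ a) r ▷ r
    trr  : ∀ {a b} (r : Path a b) → τ r (ρ b) ▷ r
    tt   : ∀ {a b c d} (t : Path a b) (r : Path b c) (s : Path c d) →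
           τ (τ t r) s ▷ τ t (τ r s)
    sr   : (a : Pt) → σ (ρ a) ▷ ρ a
    ss   : ∀ {a b} (r : Path a b) → σ (σ r) ▷ r
    σ-cong  : ∀ {a b} {r r' : Path a b} → r ▷ r' → σ r ▷ σ r'
    τ-congˡ : ∀ {a b c} {r r' : Path a b} (s : Path b c) → r ▷ r' → τ r s ▷ τ r' s
    τ-congʳ : ∀ {a b c} (r : Path a b) {s s' : Path b c} → s ▷ s' → τ r s ▷ τ r s'

  data _≡rw_ : ∀ {a b} → Path a b → Path a b → Set where
    rw-step  : ∀ {a b} {r s : Path a b} → r ▷ s → r ≡rw s
    rw-refl  : ∀ {a b} (r : Path a b) → r ≡rw r
    rw-sym   : ∀ {a b} {r s : Path a b} → r ≡rw s → s ≡rw r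
    rw-trans : ∀ {a b} {r s t : Path a b} → r ≡rw s → s ≡rw t → r ≡rw t

  φ : (x : X) → Path (inj₁ x) (inj₂ (f x))
  φ x = atom (μ x)

  fφ : (x : X) → Path (inj₁ x) (inj₁ x) → Path (inj₂ (f x)) (inj₂ (f x))
  fφ x α = τ (τ (σ (φ x)) α) (φ x)

module Submission where

-- The homomorphism property has nothing to do with φ being a transport
-- path: it holds for conjugation by ANY path p : a = b, using only the
-- rules tt (associativity), tr (τ(p, σ(p)) ▷ ρ) and tlr (τ(ρ, r) ▷ r).

open import Defs
open import Data.Sum using (inj₁)
open import Relation.Binary.Bundles using (Setoid)
import Relation.Binary.Reasoning.Setoid as SetoidReasoning

module Conjugation {X Y : Set} (BX : X → X → Set) (BY : Y → Y → Set) (f : X → Y) where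

  open Paths BX BY f

  rw-setoid : (a b : Pt) → Setoid _ _
  rw-setoid a b = record
    { Carrier       = Path a b
    ; _≈_           = _≡rw_
    ; isEquivalence = record
      { refl  = rw-refl _
      ; sym   = rw-sym
      ; trans = rw-trans
      }
    }

  τ-congˡ-rw : ∀ {a b c} {r r' : Path a b} (s : Path b c) → r ≡rw r' → τ r s ≡rw τ r' s
  τ-congˡ-rw s (rw-step e)      = rw-step (τ-congˡ s e)
  τ-congˡ-rw s (rw-refl r)      = rw-refl (τ r s)
  τ-congˡ-rw s (rw-sym e)       = rw-sym (τ-congˡ-rw s e)
  τ-congˡ-rw s (rw-trans e₁ e₂) = rw-trans (τ-congˡ-rw s e₁) (τ-congˡ-rw s e₂)

  τ-congʳ-rw : ∀ {a b c} (r : Path a b) {s s' : Path b c} → s ≡rw s' → τ r s ≡rw τ r s'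
  τ-congʳ-rw r (rw-step e)      = rw-step (τ-congʳ r e)
  τ-congʳ-rw r (rw-refl s)      = rw-refl (τ r s)
  τ-congʳ-rw r (rw-sym e)       = rw-sym (τ-congʳ-rw r e)
  τ-congʳ-rw r (rw-trans e₁ e₂) = rw-trans (τ-congʳ-rw r e₁) (τ-congʳ-rw r e₂)

  τ-assoc : ∀ {a b c d} (t : Path a b) (r : Path b c) (s : Path c d) →
            τ (τ t r) s ≡rw τ t (τ r s)
  τ-assoc t r s = rw-step (tt t r s)

  cancelˡ : ∀ {a b c} (p : Path a b) (r : Path a c) → τ p (τ (σ p) r) ≡rw r
  cancelˡ {a} p r = begin
    τ p (τ (σ p) r)  ≈⟨ rw-sym (τ-assoc p (σ p) r) ⟩
    τ (τ p (σ p)) r  ≈⟨ τ-congˡ-rw r (rw-step (tr p)) ⟩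
    τ (ρ a) r        ≈⟨ rw-step (tlr r) ⟩
    r                ∎
    where open SetoidReasoning (rw-setoid _ _)

  conj : ∀ {a b} → Path a b → Path a a → Path b b
  conj p α = τ (τ (σ p) α) p

  conj-unfoldˡ : ∀ {a b} (p : Path a b) (β : Path a a) → τ p (conj p β) ≡rw τ β p
  conj-unfoldˡ p β = begin
    τ p (τ (τ (σ p) β) p)  ≈⟨ rw-sym (τ-assoc p (τ (σ p) β) p) ⟩
    τ (τ p (τ (σ p) β)) p  ≈⟨ τ-congˡ-rw p (cancelˡ p β) ⟩
    τ β p                  ∎
    where open SetoidReasoning (rw-setoid _ _)

  -- Conjugation by p is multiplicative: p⁻¹·(α·β)·p = (p⁻¹·α·p)·(p⁻¹·β·p).
  -- The product on the right contains p·(p⁻¹·β·p), which is β·p.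
  conj-τ : ∀ {a b} (p : Path a b) (α β : Path a a) →
           conj p (τ α β) ≡rw τ (conj p α) (conj p β)
  conj-τ {b = b} p α β = begin
    τ (τ (σ p) (τ α β)) p           ≈⟨ τ-congˡ-rw p (rw-sym (τ-assoc (σ p) α β)) ⟩
    τ (τ (τ (σ p) α) β) p           ≈⟨ τ-assoc (τ (σ p) α) β p ⟩
    τ (τ (σ p) α) (τ β p)           ≈⟨ τ-congʳ-rw (τ (σ p) α) (rw-sym (conj-unfoldˡ p β)) ⟩
    τ (τ (σ p) α) (τ p (conj p β))  ≈⟨ rw-sym (τ-assoc (τ (σ p) α) p (conj p β)) ⟩
    τ (conj p α) (conj p β)         ∎
    where open SetoidReasoning (rw-setoid b b)

mainTheorem7 : {X Y : Set} (BX : X → X → Set) (BY : Y → Y → Set) (f : X → Y) →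
    let open Paths BX BY f in
    (x : X) (α β : Path (inj₁ x) (inj₁ x)) →
    fφ x (β ∘ₚ α) ≡rw (fφ x β ∘ₚ fφ x α)
mainTheorem7 BX BY f x α β = conj-τ (φ x) α β
  where
  open Paths BX BY f
  open Conjugation BX BY f
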